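{- No deterministic max-finding algorithm has error less than $2$: for every deterministic algorithm $A$ that, given elements, uses comparator queries and outputs one of the elements, there exist an input and comparator answers consistent with the model such that the output $x$ satisfies $\mathrm{val}(x)\le \max_i \mathrm{val}(x_i) - 2$.
   Context: Model: each element $x_i$ has an unknown real value $\mathrm{val}(x_i)$. An algorithm may query the comparator on a pair $x_i,x_j$; it answers either "$x_i\ge x_j$" or "$x_j\ge x_i$". If $|\mathrm{val}(x_i)-\mathrm{val}(x_j)|>1$ the answer is correct; otherwise the answer is arbitrary (possibly adversarial). The error of a max-finding algorithm is the least $k$ such that on every input and every comparator behavior consistent with the model its output $x$ satisfies $\mathrm{val}(x)\ge \mathrm{val}(x_i)-k$ for all $i$. -}

module Defs where

open import Data.Nat using (ℕ; suc)
open import Data.Fin using (Fin)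
open import Data.Bool using (Bool; true; false)
open import Data.Product using (_×_)
open import Data.Rational using (ℚ; 1ℚ; _+_; _<_)
open import Relation.Binary.PropositionalEquality using (_≡_)

-- A deterministic comparison-based algorithm on n elements, as a decision tree.
-- `query i j k`: ask the comparator on (x_i, x_j); answer `true` means
-- "x_i ≥ x_j", answer `false` means "x_j ≥ x_i"; continue with `k answer`.
-- `output i`: output element x_i.
data Alg (n : ℕ) : Set where
  output : Fin n → Alg n
  query  : Fin n → Fin n → (Bool → Alg n) → Alg n

-- A max-finding algorithm: for every number of elements (at least one).
MaxAlg : Set
MaxAlg = (n : ℕ) → Alg (suc n)

-- A comparator: `c i j ≡ true` means it answers "x_i ≥ x_j" on query (x_i, x_j),
-- `false` means "x_j ≥ x_i".
Comparator : ℕ → Set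
Comparator n = Fin n → Fin n → Bool

Consistent : ∀ {n} → (Fin n → ℚ) → Comparator n → Set
Consistent {n} val c = (i j : Fin n) →
  ((val j + 1ℚ < val i) → c i j ≡ true) × ((val i + 1ℚ < val j) → c i j ≡ false)

run : ∀ {n} → Alg n → Comparator n → Fin n
run (output i) c = i
run (query i j k) c = run (k (c i j)) c

2ℚ : ℚ
2ℚ = 1ℚ + 1ℚ

module Submission where

-- The adversary fixes its answers in advance: the cyclic tournament
-- `beats` on Fin 3, where 0 beats 1, 1 beats 2 and 2 beats 0.  A
-- deterministic algorithm run against these answers outputs some element o.
-- Whatever o is, the same answers are consistent with the valuation
-- `placing o`, which gives o the value 0, the element o beats the value 1,
-- and the element beating o the value 2; so o lies 2 below the maximum.

open import Defs
open import Data.Nat using (ℕ; suc)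
open import Data.Fin using (Fin; zero; suc)
open import Data.Bool using (true; false)
open import Data.Product using (Σ; _×_; ∃; _,_)
open import Data.Rational using (ℚ; _+_; _≤_; _<_; 0ℚ; 1ℚ)
open import Data.Rational.Properties
  using (_<?_; <-asym; +-monoʳ-<; +-identityʳ; +-identityˡ; positive⁻¹; ≤-reflexive)
open import Data.Empty using (⊥-elim)
open import Function using (_∘_)
open import Relation.Nullary using (¬_)
open import Relation.Nullary.Decidable using (toWitnessFalse)
open import Relation.Binary.PropositionalEquality using (_≡_; refl; sym; trans; subst)

no-self-gap : ∀ q → ¬ (q + 1ℚ < q)
no-self-gap q = <-asym q<q+1
  where
  q<q+1 : q < q + 1ℚ
  q<q+1 = subst (_< q + 1ℚ) (+-identityʳ q) (+-monoʳ-< q (positive⁻¹ 1ℚ))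

RespectsGaps : ∀ {n} → (Fin n → ℚ) → Comparator n → Set
RespectsGaps {n} val c = (i j : Fin n) → val j + 1ℚ < val i → c i j ≡ true

Antisymmetric : ∀ {n} → Comparator n → Set
Antisymmetric {n} c = (i j : Fin n) → c i j ≡ true → c j i ≡ true → i ≡ j

-- For an antisymmetric comparator the second half of `Consistent` follows
-- from the first: if x_j is far above x_i then c answers "x_j ≥ x_i", hence
-- not "x_i ≥ x_j".
consistent-from-gaps : ∀ {n} {val : Fin n → ℚ} {c : Comparator n} →
  Antisymmetric c → RespectsGaps val c → Consistent val c
consistent-from-gaps {val = val} {c} antisym respects i j =
  respects i j , answers-false
  where
  answers-false : val i + 1ℚ < val j → c i j ≡ false
  answers-false gap with c i j in c-ij
  ... | false = refl
  ... | true with antisym i j c-ij (respects j i gap)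
  ...   | refl = ⊥-elim (no-self-gap (val i) gap)

respects-gaps-∘ : ∀ {n} {val : Fin n → ℚ} {c : Comparator n} (σ : Fin n → Fin n) →
  (∀ i j → c (σ i) (σ j) ≡ c i j) → RespectsGaps val c → RespectsGaps (val ∘ σ) c
respects-gaps-∘ σ symmetry respects i j gap =
  trans (sym (symmetry i j)) (respects (σ i) (σ j) gap)

beats : Comparator 3
beats zero             zero             = true
beats zero             (suc zero)       = true
beats zero             (suc (suc zero)) = false
beats (suc zero)       zero             = false
beats (suc zero)       (suc zero)       = true
beats (suc zero)       (suc (suc zero)) = true
beats (suc (suc zero)) zero             = true
beats (suc (suc zero)) (suc zero)       = false
beats (suc (suc zero)) (suc (suc zero)) = true

prev : Fin 3 → Fin 3
prev zero             = suc (suc zero)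
prev (suc zero)       = zero
prev (suc (suc zero)) = suc zero

beats-antisymmetric : Antisymmetric beats
beats-antisymmetric zero             zero             _ _ = refl
beats-antisymmetric (suc zero)       (suc zero)       _ _ = refl
beats-antisymmetric (suc (suc zero)) (suc (suc zero)) _ _ = refl
beats-antisymmetric zero             (suc (suc zero)) ()
beats-antisymmetric (suc zero)       zero             ()
beats-antisymmetric (suc (suc zero)) (suc zero)       ()
beats-antisymmetric zero             (suc zero)       _ ()
beats-antisymmetric (suc zero)       (suc (suc zero)) _ ()
beats-antisymmetric (suc (suc zero)) zero             _ ()

beats-prev : ∀ i j → beats (prev i) (prev j) ≡ beats i j
beats-prev zero             zero             = refl
beats-prev zero             (suc zero)       = refl
beats-prev zero             (suc (suc zero)) = refl
beats-prev (suc zero)       zero             = refl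
beats-prev (suc zero)       (suc zero)       = refl
beats-prev (suc zero)       (suc (suc zero)) = refl
beats-prev (suc (suc zero)) zero             = refl
beats-prev (suc (suc zero)) (suc zero)       = refl
beats-prev (suc (suc zero)) (suc (suc zero)) = refl

-- The base valuation: element k gets value k.  Along the cycle only the
-- pair (2, 0) is more than 1 apart, and there 2 beats 0 as required.
height : Fin 3 → ℚ
height zero             = 0ℚ
height (suc zero)       = 1ℚ
height (suc (suc zero)) = 2ℚ

height-respects-gaps : RespectsGaps height beats
height-respects-gaps zero             zero             _ = refl
height-respects-gaps zero             (suc zero)       _ = refl
height-respects-gaps zero             (suc (suc zero)) gap =
  ⊥-elim (toWitnessFalse {a? = _ <? _} _ gap)
height-respects-gaps (suc zero)       zero             gap =
  ⊥-elim (toWitnessFalse {a? = _ <? _} _ gap)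
height-respects-gaps (suc zero)       (suc zero)       _ = refl
height-respects-gaps (suc zero)       (suc (suc zero)) _ = refl
height-respects-gaps (suc (suc zero)) zero             _ = refl
height-respects-gaps (suc (suc zero)) (suc zero)       gap =
  ⊥-elim (toWitnessFalse {a? = _ <? _} _ gap)
height-respects-gaps (suc (suc zero)) (suc (suc zero)) _ = refl

-- The valuation putting o at the bottom: `height` rotated so that o gets 0
-- and its predecessor `prev o` gets 2.
placing : Fin 3 → Fin 3 → ℚ
placing zero             = height
placing (suc zero)       = height ∘ prev
placing (suc (suc zero)) = height ∘ prev ∘ prev

placing-respects-gaps : ∀ o → RespectsGaps (placing o) beats
placing-respects-gaps zero             = height-respects-gaps
placing-respects-gaps (suc zero)       =
  respects-gaps-∘ prev beats-prev height-respects-gaps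
placing-respects-gaps (suc (suc zero)) =
  respects-gaps-∘ prev beats-prev (placing-respects-gaps (suc zero))

placing-consistent : ∀ o → Consistent (placing o) beats
placing-consistent o = consistent-from-gaps beats-antisymmetric (placing-respects-gaps o)

placing-gap : ∀ o → placing o o + 2ℚ ≤ placing o (prev o)
placing-gap zero             = ≤-reflexive (+-identityˡ 2ℚ)
placing-gap (suc zero)       = ≤-reflexive (+-identityˡ 2ℚ)
placing-gap (suc (suc zero)) = ≤-reflexive (+-identityˡ 2ℚ)

theorem2 : (A : MaxAlg) →
    Σ ℕ λ n → Σ (Fin (suc n) → ℚ) λ val → Σ (Comparator (suc n)) λ c →
      Consistent val c × ∃ λ i → val (run (A n) c) + 2ℚ ≤ val i
theorem2 A = 2 , placing o , beats , placing-consistent o , prev o , placing-gap o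
  where
  o : Fin 3
  o = run (A 2) beats
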